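{- Let $G$ be a directed graph with positive edge weights $w\colon E(G)\to\mathbb{R}_{+}$ and $s,t\in V(G)$. Let $d_s(v)$ denote the shortest-path distance from $s$ to $v$ in $(G,w)$. Let $G'$ be obtained from $G$ by deleting every edge $e=(u,v)$ with $d_s(v)\neq d_s(u)+w(e)$, and then deleting every vertex (with its incident edges) that is not reachable from $s$ or from which $t$ is not reachable. Then for every $S\subseteq E(G)$: $S$ is a minimal forcing set for shortest $s$-$t$ paths in $(G,w)$ if and only if $S$ is a minimal forcing set for $s$-$t$ paths in $G'$; and $S$ is a minimal anti-forcing set for shortest $s$-$t$ paths in $(G,w)$ if and only if $S$ is a minimal anti-forcing set for $s$-$t$ paths in $G'$.
   Context: A set $S$ of edges is a forcing set (resp. anti-forcing set) for shortest $s$-$t$ paths if there is exactly one shortest $s$-$t$ path $P$ with $S\subseteq E(P)$ (resp. $S\cap E(P)=\varnothing$). In $G'$ every $s$-$t$ path is a shortest $s$-$t$ path of $(G,w)$ and vice versa, so forcing/anti-forcing sets in $G'$ are taken with respect to all $s$-$t$ paths of $G'$. A forcing (resp. anti-forcing) set is minimal if no proper subset of it is a forcing (resp. anti-forcing) set. -}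

module Defs where

open import Level using (Level; _⊔_) renaming (suc to lsuc)
open import Data.Nat using (ℕ)
open import Data.Fin using (Fin)
open import Data.Fin.Subset using (Subset) renaming (_∈_ to _∈ₛ_; _⊂_ to _⊂ₛ_)
open import Data.List using (List; []; _∷_; foldr)
open import Data.List.Membership.Propositional using (_∈_)
open import Data.List.Relation.Unary.All using (All)
open import Data.List.Relation.Unary.Unique.Propositional using (Unique)
open import Data.Product using (Σ; ∃; ∃₂; _×_; _,_)
open import Relation.Nullary using (¬_)
open import Relation.Binary.Core using (Rel)
open import Relation.Binary.Structures using (IsTotalOrder)
open import Relation.Binary.PropositionalEquality using (_≡_)
open import Algebra.Bundles using (AbelianGroup)

-- Weights: an arbitrary totally ordered abelian group (ℝ is an instance).

record OrderedAbGroup (c ℓ₁ ℓ₂ : Level) : Set (lsuc (c ⊔ ℓ₁ ⊔ ℓ₂)) where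
  field
    abelianGroup : AbelianGroup c ℓ₁
  open AbelianGroup abelianGroup public
  infix 4 _≤_
  field
    _≤_          : Rel Carrier ℓ₂
    isTotalOrder : IsTotalOrder _≈_ _≤_
    ∙-mono-≤     : ∀ {a b} c → a ≤ b → (a ∙ c) ≤ (b ∙ c)

  _<_ : Rel Carrier (ℓ₁ ⊔ ℓ₂)
  a < b = (a ≤ b) × ¬ (a ≈ b)

record Digraph : Set where
  field
    nV nE : ℕ
    src tgt : Fin nE → Fin nV

module Paths (G : Digraph) where
  open Digraph G

  Vertex : Set
  Vertex = Fin nV

  Edge : Set
  Edge = Fin nE

  IsWalk : Vertex → Vertex → List Edge → Set
  IsWalk u v []       = u ≡ v
  IsWalk u v (e ∷ es) = (src e ≡ u) × IsWalk (tgt e) v es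

  verts : Vertex → List Edge → List Vertex
  verts u []       = u ∷ []
  verts u (e ∷ es) = u ∷ verts (tgt e) es

  IsPath : Vertex → Vertex → List Edge → Set
  IsPath u v es = IsWalk u v es × Unique (verts u es)

  _⊆E_ : Subset nE → List Edge → Set
  S ⊆E P = ∀ e → e ∈ₛ S → e ∈ P

  _#E_ : Subset nE → List Edge → Set
  S #E P = ∀ e → e ∈ₛ S → ¬ (e ∈ P)

  Forcing : ∀ {ℓ} → (List Edge → Set ℓ) → Subset nE → Set ℓ
  Forcing Adm S = ∃ λ P → Adm P × S ⊆E P × (∀ Q → Adm Q → S ⊆E Q → Q ≡ P)

  AntiForcing : ∀ {ℓ} → (List Edge → Set ℓ) → Subset nE → Set ℓ
  AntiForcing Adm S = ∃ λ P → Adm P × S #E P × (∀ Q → Adm Q → S #E Q → Q ≡ P)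

  MinimalForcing : ∀ {ℓ} → (List Edge → Set ℓ) → Subset nE → Set ℓ
  MinimalForcing Adm S = Forcing Adm S × (∀ T → T ⊂ₛ S → ¬ Forcing Adm T)

  MinimalAntiForcing : ∀ {ℓ} → (List Edge → Set ℓ) → Subset nE → Set ℓ
  MinimalAntiForcing Adm S = AntiForcing Adm S × (∀ T → T ⊂ₛ S → ¬ AntiForcing Adm T)

module Weighted {c ℓ₁ ℓ₂} (O : OrderedAbGroup c ℓ₁ ℓ₂) (G : Digraph)
                (w : Fin (Digraph.nE G) → OrderedAbGroup.Carrier O)
                (s t : Fin (Digraph.nV G)) where
  open OrderedAbGroup O
  open Digraph G
  open Paths G

  weight : List Edge → Carrier
  weight = foldr (λ e acc → w e ∙ acc) ε

  ShortestTo : Vertex → List Edge → Set (ℓ₂)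
  ShortestTo v P = IsPath s v P × (∀ Q → IsPath s v Q → weight P ≤ weight Q)

  ShortestST : List Edge → Set ℓ₂
  ShortestST = ShortestTo t

  -- e = (u,v) satisfies d_s(v) = d_s(u) + w(e)  (u, v reachable from s)
  Tight : Edge → Set (ℓ₁ ⊔ ℓ₂)
  Tight e = ∃₂ λ P Q → ShortestTo (src e) P × ShortestTo (tgt e) Q
                       × (weight Q ≈ weight P ∙ w e)

  -- G₁ : G with all non-tight edges deleted; walks in G₁
  WalkG₁ : Vertex → Vertex → List Edge → Set (ℓ₁ ⊔ ℓ₂)
  WalkG₁ u v P = IsWalk u v P × All Tight P

  InV' : Vertex → Set (ℓ₁ ⊔ ℓ₂)
  InV' v = (∃ λ P → WalkG₁ s v P) × (∃ λ Q → WalkG₁ v t Q)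

  InE' : Edge → Set (ℓ₁ ⊔ ℓ₂)
  InE' e = Tight e × InV' (src e) × InV' (tgt e)

  PathG' : List Edge → Set (ℓ₁ ⊔ ℓ₂)
  PathG' P = IsPath s t P × All InE' P × All InV' (verts s P)

-- Forcing and anti-forcing only depend on the family of admissible paths, so it
-- suffices that the shortest s-t paths of (G, w) are exactly the s-t paths of G'.
-- Non-negative weights let every walk be shortened to a path, so prefixes of a
-- shortest path are shortest; hence all its edges are tight and all its vertices
-- lie on a tight s-t walk. Conversely d_s grows by exactly w(e) along a tight edge
-- e, so every s-t path built from tight edges has weight d_s(t).
module Submission where

open import Defs
open import Data.Fin using (Fin) renaming (_≟_ to _≟ᶠ_)
open import Data.Fin.Subset using (Subset) renaming (_⊂_ to _⊂ₛ_)
open import Data.Product using (_×_; _,_; proj₁; ∃)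
open import Data.List using (List; []; _∷_; _++_; [_])
open import Data.List.Properties using (++-assoc)
open import Data.List.Relation.Unary.All as All using (All; []; _∷_)
open import Data.List.Relation.Unary.All.Properties using (¬Any⇒All¬; ++⁺; anti-mono)
open import Data.List.Relation.Unary.Any using (here; there)
open import Data.List.Relation.Unary.AllPairs using ([]; _∷_)
open import Data.List.Relation.Unary.Unique.Propositional using (Unique)
open import Data.List.Relation.Binary.Subset.Propositional using (_⊆_)
open import Data.List.Membership.Propositional using (_∈_)
open import Data.List.Membership.Propositional.Properties using (∈-∃++)
open import Function.Bundles using (_⇔_; mk⇔; module Equivalence)
open import Function.Properties.Equivalence using () renaming (sym to ⇔-sym)
open import Relation.Binary.Bundles using (Poset)
open import Relation.Binary.Structures using (IsTotalOrder)
open import Relation.Binary.PropositionalEquality as ≡ using (_≡_; refl)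
open import Relation.Nullary using (¬_; yes; no)
open import Relation.Unary using (_≐′_)
open import Relation.Unary.Properties using (≐′-sym)

module Determination (G : Digraph) where
  open Digraph G
  open Paths G

  -- Forcing and AntiForcing are Determines _⊆E_ and Determines _#E_, and
  -- MinimalForcing Adm is Minimal (Forcing Adm), all definitionally.
  Determines : ∀ {ℓ} → (Subset nE → List Edge → Set) → (List Edge → Set ℓ) →
               Subset nE → Set ℓ
  Determines _~_ Adm S = ∃ λ P → Adm P × S ~ P × (∀ Q → Adm Q → S ~ Q → Q ≡ P)

  Minimal : ∀ {ℓ} → (Subset nE → Set ℓ) → Subset nE → Set ℓ
  Minimal X S = X S × (∀ T → T ⊂ₛ S → ¬ X T)

  module _ (_~_ : Subset nE → List Edge → Set) where

    determines-resp-≐′ : ∀ {a b} {A : List Edge → Set a} {B : List Edge → Set b} →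
                         A ≐′ B → ∀ S → Determines _~_ A S → Determines _~_ B S
    determines-resp-≐′ (A⊆B , B⊆A) S (P , AP , S~P , unique) =
      P , A⊆B P AP , S~P , λ Q BQ → unique Q (B⊆A Q BQ)

    determines-cong : ∀ {a b} {A : List Edge → Set a} {B : List Edge → Set b} →
                      A ≐′ B → ∀ S → Determines _~_ A S ⇔ Determines _~_ B S
    determines-cong A≐B S =
      mk⇔ (determines-resp-≐′ A≐B S) (determines-resp-≐′ (≐′-sym A≐B) S)

  minimal-cong : ∀ {a b} {X : Subset nE → Set a} {Y : Subset nE → Set b} →
                 (∀ S → X S ⇔ Y S) → ∀ S → Minimal X S ⇔ Minimal Y S
  minimal-cong X⇔Y S = mk⇔ (transfer X⇔Y) (transfer (λ T → ⇔-sym (X⇔Y T)))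
    where
    open Equivalence
    transfer : ∀ {p q} {P : Subset nE → Set p} {Q : Subset nE → Set q} →
               (∀ T → P T ⇔ Q T) → Minimal P S → Minimal Q S
    transfer P⇔Q (PS , minimal) =
      to (P⇔Q S) PS , λ T T⊂S QT → minimal T T⊂S (from (P⇔Q T) QT)

module OrderedAbGroupProperties {c ℓ₁ ℓ₂} (O : OrderedAbGroup c ℓ₁ ℓ₂) where
  open OrderedAbGroup O
  open import Algebra.Properties.Group group using (//-rightDividesʳ)

  poset : Poset c ℓ₁ ℓ₂
  poset = record { isPartialOrder = IsTotalOrder.isPartialOrder isTotalOrder }

  open Poset poset public using ()
    renaming (refl to ≤-refl; trans to ≤-trans; antisym to ≤-antisym)
  open import Relation.Binary.Reasoning.PartialOrder poset

  ∙-monoˡ-≤ : ∀ a {b c} → b ≤ c → a ∙ b ≤ a ∙ c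
  ∙-monoˡ-≤ a {b} {c} b≤c = begin
    a ∙ b  ≈⟨ comm a b ⟩
    b ∙ a  ≤⟨ ∙-mono-≤ a b≤c ⟩
    c ∙ a  ≈⟨ comm c a ⟩
    a ∙ c  ∎

  x≤y∙x : ∀ x {y} → ε ≤ y → x ≤ y ∙ x
  x≤y∙x x {y} ε≤y = begin
    x      ≈⟨ identityˡ x ⟨
    ε ∙ x  ≤⟨ ∙-mono-≤ x ε≤y ⟩
    y ∙ x  ∎

  ∙-cancelʳ-≤ : ∀ c {a b} → a ∙ c ≤ b ∙ c → a ≤ b
  ∙-cancelʳ-≤ c {a} {b} ac≤bc = begin
    a               ≈⟨ //-rightDividesʳ c a ⟨
    a ∙ c ∙ c ⁻¹    ≤⟨ ∙-mono-≤ (c ⁻¹) ac≤bc ⟩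
    b ∙ c ∙ c ⁻¹    ≈⟨ //-rightDividesʳ c b ⟩
    b               ∎

module WalkProperties (G : Digraph) where
  open Digraph G
  open Paths G

  IsWalk-++ : ∀ {u x v} A B → IsWalk u x A → IsWalk x v B → IsWalk u v (A ++ B)
  IsWalk-++ []      B refl             walkB = walkB
  IsWalk-++ (e ∷ A) B (srcE , walkA) walkB = srcE , IsWalk-++ A B walkA walkB

  IsWalk-++⁻ : ∀ {u v} A B → IsWalk u v (A ++ B) → ∃ λ x → IsWalk u x A × IsWalk x v B
  IsWalk-++⁻ {u} [] B walkB = u , refl , walkB
  IsWalk-++⁻ (e ∷ A) B (srcE , walk) with x , walkA , walkB ← IsWalk-++⁻ A B walk =
    x , (srcE , walkA) , walkB

  start∈verts : ∀ v B → v ∈ verts v B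
  start∈verts v []      = here refl
  start∈verts v (_ ∷ _) = here refl

  All-verts-start : ∀ {p} {Q : Vertex → Set p} v B → All Q (verts v B) → Q v
  All-verts-start v []      (Qv ∷ _) = Qv
  All-verts-start v (_ ∷ _) (Qv ∷ _) = Qv

  verts-++⁺ˡ : ∀ v A B → verts v A ⊆ verts v (A ++ B)
  verts-++⁺ˡ v []      B (here refl) = start∈verts v B
  verts-++⁺ˡ v (e ∷ A) B (here refl) = here refl
  verts-++⁺ˡ v (e ∷ A) B (there y∈A) = there (verts-++⁺ˡ (tgt e) A B y∈A)

  Unique-verts-++⁻ˡ : ∀ u A B → Unique (verts u (A ++ B)) → Unique (verts u A)
  Unique-verts-++⁻ˡ u []      B _            = [] ∷ []
  Unique-verts-++⁻ˡ u (e ∷ A) B (u∉ ∷ uniq) =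
    anti-mono (verts-++⁺ˡ (tgt e) A B) u∉ ∷ Unique-verts-++⁻ˡ (tgt e) A B uniq

module ShortestPaths {c ℓ₁ ℓ₂} (O : OrderedAbGroup c ℓ₁ ℓ₂) (G : Digraph)
    (w : Fin (Digraph.nE G) → OrderedAbGroup.Carrier O)
    (wpos : ∀ e → OrderedAbGroup._<_ O (OrderedAbGroup.ε O) (w e))
    (s t : Fin (Digraph.nV G)) where
  open OrderedAbGroup O hiding (refl)
  open OrderedAbGroupProperties O
  open Digraph G
  open Paths G
  open WalkProperties G
  open Weighted O G w s t
  open import Relation.Binary.Reasoning.PartialOrder poset
  open import Data.List.Membership.DecPropositional (_≟ᶠ_ {nV}) using (_∈?_)

  weight-++ : ∀ A B → weight (A ++ B) ≈ weight A ∙ weight B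
  weight-++ []      B = sym (identityˡ (weight B))
  weight-++ (e ∷ A) B = begin-equality
    w e ∙ weight (A ++ B)        ≈⟨ ∙-congˡ (weight-++ A B) ⟩
    w e ∙ (weight A ∙ weight B)  ≈⟨ assoc (w e) (weight A) (weight B) ⟨
    w e ∙ weight A ∙ weight B    ∎

  weight-∷ʳ : ∀ A e → weight (A ++ [ e ]) ≈ weight A ∙ w e
  weight-∷ʳ A e = trans (weight-++ A [ e ]) (∙-congˡ (identityʳ (w e)))

  weight-≤-∷ : ∀ e W → weight W ≤ weight (e ∷ W)
  weight-≤-∷ e W = x≤y∙x (weight W) (proj₁ (wpos e))

  weight-nonneg : ∀ W → ε ≤ weight W
  weight-nonneg []      = ≤-refl
  weight-nonneg (e ∷ W) = ≤-trans (weight-nonneg W) (weight-≤-∷ e W)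

  PathNoHeavierThan : Vertex → Vertex → List Edge → Set ℓ₂
  PathNoHeavierThan u v W = ∃ λ P → IsPath u v P × weight P ≤ weight W

  path-suffix : ∀ {u x v} P → u ∈ verts x P → IsPath x v P → PathNoHeavierThan u v P
  path-suffix []      (here refl) path = [] , path , ≤-refl
  path-suffix (e ∷ P) (here refl) path = e ∷ P , path , ≤-refl
  path-suffix (e ∷ P) (there u∈P) ((_ , walk) , _ ∷ uniq)
    with Q , pathQ , Q≤P ← path-suffix P u∈P (walk , uniq) =
    Q , pathQ , ≤-trans Q≤P (weight-≤-∷ e P)

  walk⇒path : ∀ {u v} W → IsWalk u v W → PathNoHeavierThan u v W
  walk⇒path []      walk = [] , (walk , [] ∷ []) , ≤-refl
  walk⇒path (e ∷ W) (refl , walk) with walk⇒path W walk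
  ... | P , (walkP , uniqP) , P≤W with src e ∈? verts (tgt e) P
  ...   | yes src∈P with Q , pathQ , Q≤P ← path-suffix P src∈P (walkP , uniqP) =
    Q , pathQ , ≤-trans Q≤P (≤-trans P≤W (weight-≤-∷ e W))
  ...   | no src∉P =
    e ∷ P , ((refl , walkP) , ¬Any⇒All¬ _ src∉P ∷ uniqP) , ∙-monoˡ-≤ (w e) P≤W

  shortest-prefix : ∀ {x v} A B → ShortestTo v (A ++ B) →
                    IsWalk s x A → IsWalk x v B → ShortestTo x A
  shortest-prefix {x} A B ((_ , uniq) , minimal) walkA walkB =
    (walkA , Unique-verts-++⁻ˡ s A B uniq) , A-minimal
    where
    A-minimal : ∀ Q → IsPath s x Q → weight A ≤ weight Q
    A-minimal Q (walkQ , _)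
      with R , pathR , R≤QB ← walk⇒path (Q ++ B) (IsWalk-++ Q B walkQ walkB) =
      ∙-cancelʳ-≤ (weight B) (begin
        weight A ∙ weight B  ≈⟨ weight-++ A B ⟨
        weight (A ++ B)      ≤⟨ minimal R pathR ⟩
        weight R             ≤⟨ R≤QB ⟩
        weight (Q ++ B)      ≈⟨ weight-++ Q B ⟩
        weight Q ∙ weight B  ∎)

  shortest-edge-tight : ∀ A e B → ShortestST (A ++ e ∷ B) → Tight e
  shortest-edge-tight A e B shortest@((walk , _) , _)
    with _ , walkA , (refl , walkB) ← IsWalk-++⁻ A (e ∷ B) walk =
    A , A ++ [ e ] ,
    shortest-prefix A (e ∷ B) shortest walkA (refl , walkB) ,
    shortest-prefix (A ++ [ e ]) B shortest′
      (IsWalk-++ A [ e ] walkA (refl , refl)) walkB ,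
    weight-∷ʳ A e
    where
    shortest′ : ShortestST ((A ++ [ e ]) ++ B)
    shortest′ = ≡.subst ShortestST (≡.sym (++-assoc A [ e ] B)) shortest

  shortest⇒All-Tight : ∀ P → ShortestST P → All Tight P
  shortest⇒All-Tight P shortest = All.tabulate λ e∈P →
    let A , B , P≡A++e∷B = ∈-∃++ e∈P
    in shortest-edge-tight A _ B (≡.subst ShortestST P≡A++e∷B shortest)

  tight-walk⇒All-InV'-verts : ∀ {x} A B → WalkG₁ s x A → WalkG₁ x t B →
                              All InV' (verts x B)
  tight-walk⇒All-InV'-verts A [] walkA walkB = ((A , walkA) , ([] , walkB)) ∷ []
  tight-walk⇒All-InV'-verts A (e ∷ B) walkA@(walkA′ , tightA)
                            walkEB@((srcE , walkB) , tightE ∷ tightB) =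
    ((A , walkA) , (e ∷ B , walkEB)) ∷
    tight-walk⇒All-InV'-verts (A ++ [ e ]) B
      (IsWalk-++ A [ e ] walkA′ (srcE , refl) , ++⁺ tightA (tightE ∷ []))
      (walkB , tightB)

  All-InE' : ∀ {x v} B → IsWalk x v B → All Tight B → All InV' (verts x B) → All InE' B
  All-InE' []      _              _                _             = []
  All-InE' (e ∷ B) (refl , walkB) (tightE ∷ tightB) (srcE' ∷ rest) =
    (tightE , srcE' , All-verts-start (tgt e) B rest) ∷ All-InE' B walkB tightB rest

  shortest⇒G'-path : ∀ P → ShortestST P → PathG' P
  shortest⇒G'-path P shortest@(path@(walk , _) , _) =
    path , All-InE' P walk tight V'-verts , V'-verts
    where
    tight : All Tight P
    tight = shortest⇒All-Tight P shortest
    V'-verts : All InV' (verts s P)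
    V'-verts = tight-walk⇒All-InV'-verts [] P (refl , []) (walk , tight)

  shortest-weight-unique : ∀ {u} R R′ → ShortestTo u R → ShortestTo u R′ →
                           weight R ≈ weight R′
  shortest-weight-unique R R′ (pathR , minR) (pathR′ , minR′) =
    ≤-antisym (minR R′ pathR′) (minR′ R pathR)

  tight-walk-extends-shortest : ∀ {u v} W → IsWalk u v W → All Tight W →
    ∀ R → ShortestTo u R → ∃ λ R′ → ShortestTo v R′ × weight R ∙ weight W ≈ weight R′
  tight-walk-extends-shortest [] refl [] R shortestR =
    R , shortestR , identityʳ (weight R)
  tight-walk-extends-shortest (e ∷ W) (refl , walk)
                              ((P , Q , shortestP , shortestQ , Q≈P+e) ∷ tight) R shortestR
    with R′ , shortestR′ , Q+W≈R′ ← tight-walk-extends-shortest W walk tight Q shortestQ =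
    R′ , shortestR′ , (begin-equality
      weight R ∙ (w e ∙ weight W)  ≈⟨ assoc (weight R) (w e) (weight W) ⟨
      weight R ∙ w e ∙ weight W    ≈⟨ ∙-congʳ (∙-congʳ R≈P) ⟩
      weight P ∙ w e ∙ weight W    ≈⟨ ∙-congʳ Q≈P+e ⟨
      weight Q ∙ weight W          ≈⟨ Q+W≈R′ ⟩
      weight R′                    ∎)
    where
    R≈P : weight R ≈ weight P
    R≈P = shortest-weight-unique R P shortestR shortestP

  shortest-empty : ShortestTo s []
  shortest-empty = (refl , [] ∷ []) , λ Q _ → weight-nonneg Q

  G'-path⇒shortest : ∀ P → PathG' P → ShortestST P
  G'-path⇒shortest P (path@(walk , _) , inE' , _)
    with R , (_ , minR) , P≈R
           ← tight-walk-extends-shortest P walk (All.map proj₁ inE') [] shortest-empty =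
    path , λ Q pathQ → begin
      weight P      ≈⟨ identityˡ (weight P) ⟨
      ε ∙ weight P  ≈⟨ P≈R ⟩
      weight R      ≤⟨ minR Q pathQ ⟩
      weight Q      ∎

  shortest≐G'-path : ShortestST ≐′ PathG'
  shortest≐G'-path = shortest⇒G'-path , G'-path⇒shortest

mainTheorem6 : ∀ {c ℓ₁ ℓ₂} (O : OrderedAbGroup c ℓ₁ ℓ₂) (G : Digraph)
    (w : Fin (Digraph.nE G) → OrderedAbGroup.Carrier O)
    (wpos : ∀ e → OrderedAbGroup._<_ O (OrderedAbGroup.ε O) (w e))
    (s t : Fin (Digraph.nV G)) (S : Subset (Digraph.nE G)) →
    (Paths.MinimalForcing G (Weighted.ShortestST O G w s t) S
    ⇔ Paths.MinimalForcing G (Weighted.PathG' O G w s t) S)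
    × (Paths.MinimalAntiForcing G (Weighted.ShortestST O G w s t) S
    ⇔ Paths.MinimalAntiForcing G (Weighted.PathG' O G w s t) S)
mainTheorem6 O G w wpos s t S =
    minimal-cong (determines-cong _⊆E_ shortest≐G'-path) S
  , minimal-cong (determines-cong _#E_ shortest≐G'-path) S
  where
  open Paths G
  open Determination G
  open ShortestPaths O G w wpos s t
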